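{- Let $2\le k\le n-2$, let $v_1,\dots,v_{\binom nk}$ be the vertices of $\Delta(k,n)$ in descending lexicographic order, let $\lambda=\lambda_{k,n}$ be the lifting function with $\lambda(v_i)=1$ for $1\le i\le n-k$ and $\lambda(v_i)=0$ otherwise, and let $\kappa=\kappa_{k,n}$ be the lifting function with $\kappa(v_i)=1$ for $1\le i\le\binom{n-1}{k-1}-1$ and $\kappa(v_i)=0$ otherwise. Then the regular subdivisions $\Delta(k,n)^\lambda$ and $\Delta(k,n)^\kappa$ are combinatorially isomorphic if and only if $k=2$.
   Context: The hypersimplex $\Delta(k,n)=\operatorname{conv}\{e_X : X\subseteq[n],\ |X|=k\}\subset\mathbb{R}^n$ with $e_X=\sum_{i\in X}e_i$; vertices are ordered in descending lexicographic order as 0/1-vectors (e.g., for $\Delta(2,4)$: $1100,1010,1001,0110,0101,0011$). A lifting function $\omega$ induces the regular subdivision $\Delta(k,n)^\omega$, whose cells are the projections (omitting the last coordinate) of the lower faces of $\operatorname{conv}\{(v,\omega(v))\}$, i.e., faces with an outer normal having negative last coordinate. -}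

module Defs where

open import Data.Bool using (Bool; true; false; if_then_else_)
open import Data.Nat as ℕ using (ℕ; zero; suc; _∸_; _<ᵇ_)
open import Data.Nat.Combinatorics using (_C_)
open import Data.Integer as ℤ using (ℤ; 0ℤ; 1ℤ; _+_; _*_; _≤_; _<_)
open import Data.List using (List; []; _∷_; _++_; map; length)
import Data.List as L
open import Data.Vec using (Vec; []; _∷_)
import Data.Vec as V
open import Data.Fin using (Fin; toℕ)
open import Data.Fin.Subset using (Subset; _∈_; _⊆_; Nonempty)
open import Data.Product using (Σ; Σ-syntax; _×_; ∃)
open import Function.Bundles using (_⇔_)
open import Relation.Binary.PropositionalEquality using (_≡_)

-- Vertices e_X of Δ(k,n) (|X| = k) as 0/1 vectors, listed in DESCENDING
-- lexicographic order (true = 1 comes before false = 0).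
verts : ℕ → (n : ℕ) → List (Vec Bool n)
verts zero    zero    = [] ∷ []
verts (suc k) zero    = []
verts zero    (suc n) = map (false ∷_) (verts zero n)
verts (suc k) (suc n) = map (true ∷_) (verts k n) ++ map (false ∷_) (verts (suc k) n)

N : ℕ → ℕ → ℕ
N k n = length (verts k n)

-- the i-th vertex v_{i+1} (0-based index i)
vertex : (k n : ℕ) → Fin (N k n) → Vec Bool n
vertex k n i = L.lookup (verts k n) i

Lifting : ℕ → ℕ → Set
Lifting k n = Fin (N k n) → ℤ

-- λ_{k,n}: λ(v_i) = 1 for 1 ≤ i ≤ n-k, else 0  (0-based: index < n-k)
liftλ : (k n : ℕ) → Lifting k n
liftλ k n i = if toℕ i <ᵇ (n ∸ k) then 1ℤ else 0ℤ

liftκ : (k n : ℕ) → Lifting k n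
liftκ k n i = if toℕ i <ᵇ (((n ∸ 1) C (k ∸ 1)) ∸ 1) then 1ℤ else 0ℤ

dot : ∀ {n} → Vec ℤ n → Vec Bool n → ℤ
dot []       []            = 0ℤ
dot (c ∷ cs) (true  ∷ bs)  = c + dot cs bs
dot (c ∷ cs) (false ∷ bs)  = dot cs bs

-- F (a set of vertex indices) is the vertex set of a lower face of
-- conv{(v, ω v)}: there is an outer normal (c, c₀) with c₀ < 0 such that
-- the linear functional attains its maximum m over the lifted points exactly at F.
-- (Integer normals suffice since all points are integral.)
IsLowerFace : (k n : ℕ) → Lifting k n → Subset (N k n) → Set
IsLowerFace k n ω F =
  Σ[ c ∈ Vec ℤ n ] Σ[ c₀ ∈ ℤ ] Σ[ m ∈ ℤ ]
    (c₀ < 0ℤ) × Nonempty F ×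
    ((i : Fin (N k n)) →
       let val = dot c (vertex k n i) + c₀ * ω i in
       (val ≤ m) × ((val ≡ m) ⇔ (i ∈ F)))

-- The regular subdivisions Δ(k,n)^ω and Δ(k,n)^ω' are combinatorially
-- isomorphic: there is an isomorphism of their face posets (faces of the
-- polyhedral complex = lower faces, identified with their vertex sets,
-- ordered by inclusion).
CombIsomorphic : (k n : ℕ) → Lifting k n → Lifting k n → Set
CombIsomorphic k n ω ω' =
  Σ[ f ∈ (Subset (N k n) → Subset (N k n)) ]
  Σ[ g ∈ (Subset (N k n) → Subset (N k n)) ]
    (∀ F → IsLowerFace k n ω F → IsLowerFace k n ω' (f F)) ×
    (∀ G → IsLowerFace k n ω' G → IsLowerFace k n ω (g G)) ×
    (∀ F → IsLowerFace k n ω F → g (f F) ≡ F) ×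
    (∀ G → IsLowerFace k n ω' G → f (g G) ≡ G) ×
    (∀ F G → IsLowerFace k n ω F → IsLowerFace k n ω G →
       (F ⊆ G) ⇔ (f F ⊆ f G))

-- For k = 2 the two liftings are equal.  For k ≥ 3 the subdivisions differ in whether some
-- vertex spans an edge with every other vertex.  Every vertex of Δ(k,n) is a lower face and
-- every lower face is nonempty, so the singletons are exactly the minimal faces; a face-poset
-- isomorphism therefore maps singletons to singletons, is induced by a bijection of the
-- vertices, and carries a universal vertex to a universal vertex.
--
-- For κ the vertex w = 1 0ⁿ⁻ᵏ 1ᵏ⁻¹ is universal.  Indeed κ(v) = v₁ − [v = w], so for a vertex
-- y ≠ w and d = k − |y ∩ w| the functional ⟨y + d·e₁, v⟩ − d·κ(v) equals |y ∩ v| + d·[v = w],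
-- which is maximal exactly at y and at w.
--
-- For λ no vertex is universal.  λ vanishes on the vertices having a zero among their first
-- two coordinates, and every vertex x has vertices y, u, z with x + y = u + z, with u and z of
-- that kind and u ∉ {x, y}.  Summing the lifted functional shows that a lower face containing
-- x and y contains u as well, so x and y span no edge.
module Submission where

open import Defs
open import Data.Bool using (Bool; true; false; if_then_else_; _∧_; not)
open import Data.Bool.Properties using () renaming (_≟_ to _≟ᵇ_)
open import Data.Nat as ℕ using (ℕ; zero; suc; _≤_; _<_; _∸_; _<ᵇ_; z≤n; s≤s)
import Data.Nat.Properties as ℕ
open import Data.Nat.Combinatorics using (_C_; nC1≡n; nCk+nC[k+1]≡[n+1]C[k+1])
open import Data.Integer as ℤ using (ℤ; 0ℤ; 1ℤ; -1ℤ; +_; _+_; _*_; -_; +≤+; +<+; -<+)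
import Data.Integer.Properties as ℤ
open import Data.Integer.Tactic.RingSolver using (solve-∀)
open import Data.List using (List; []; _∷_; _++_; _∷ʳ_; map; length; lookup; initLast; _∷ʳ′_)
open import Data.List.Properties using (length-map; length-++; map-++; ++-assoc; ++-identityʳ)
open import Data.List.Relation.Unary.All as All using (All; []; _∷_)
import Data.List.Relation.Unary.All.Properties as All
open import Data.List.Relation.Unary.Any as Any using (here)
open import Data.List.Relation.Unary.Any.Properties using (lookup-index)
open import Data.List.Membership.Propositional using () renaming (_∈_ to _∈ˡ_)
open import Data.List.Membership.Propositional.Properties using (∈-map⁺; ∈-map⁻; ∈-++⁺ˡ; ∈-++⁺ʳ; ∈-lookup)
open import Data.List.Relation.Unary.Unique.Propositional using (Unique)
import Data.List.Relation.Unary.Unique.Propositional.Properties as Unique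
open import Data.List.Relation.Unary.AllPairs using ([]; _∷_)
open import Data.Vec as Vec using (Vec; []; _∷_; head; tail; replicate)
open import Data.Vec.Properties using (≡-dec; ∷-injectiveʳ)
open import Data.Fin using (Fin; toℕ; _≟_) renaming (zero to fzero; suc to fsuc)
open import Data.Fin.Subset using (Subset; _∈_; _⊆_; _∪_; _∩_; ⁅_⁆; ∣_∣; Nonempty)
open import Data.Fin.Subset.Properties
  using (x∈⁅x⁆; x∈⁅y⁆⇒x≡y; x∈⁅y⁆⇔x≡y; x∈p∪q⁻; x∈p∪q⁺; ⊆-antisym; ∪-idem; ∣p∩q∣≤∣p∣; ∣p∩q∣≤∣q∣; ∣⊥∣≡0; ∣p∣≤n)
open import Data.Product using (Σ-syntax; ∃-syntax; _×_; _,_; proj₁; proj₂)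
import Data.Sum as Sum
open import Data.Sum using (_⊎_; inj₁; inj₂; [_,_])
open import Data.Empty using (⊥)
open import Function.Base using (_∘_; id)
open import Function.Bundles using (_⇔_; mk⇔; Equivalence)
open import Relation.Nullary using (¬_; yes; no; does; contradiction)
open import Relation.Nullary.Decidable using (dec-true; dec-false)
open import Relation.Binary.Definitions using (DecidableEquality)
open import Relation.Binary.PropositionalEquality hiding ([_])

private variable
  A B : Set
  k m n t : ℕ

⟦_⟧ : Bool → ℕ
⟦ b ⟧ = if b then 1 else 0

⟦⟧≤1 : (b : Bool) → ⟦ b ⟧ ≤ 1
⟦⟧≤1 true  = s≤s z≤n
⟦⟧≤1 false = z≤n

2m+b<2n+b′ : {m n : ℕ} (b b′ : Bool) → m < n → 2 ℕ.* m ℕ.+ ⟦ b ⟧ < 2 ℕ.* n ℕ.+ ⟦ b′ ⟧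
2m+b<2n+b′ {m} {n} b b′ m<n = begin-strict
  2 ℕ.* m ℕ.+ ⟦ b ⟧  ≤⟨ ℕ.+-monoʳ-≤ (2 ℕ.* m) (⟦⟧≤1 b) ⟩
  2 ℕ.* m ℕ.+ 1      <⟨ ℕ.+-monoʳ-< (2 ℕ.* m) (ℕ.n<1+n 1) ⟩
  2 ℕ.* m ℕ.+ 2      ≡⟨ ℕ.+-comm (2 ℕ.* m) 2 ⟩
  2 ℕ.+ 2 ℕ.* m      ≡⟨ ℕ.*-suc 2 m ⟨
  2 ℕ.* suc m        ≤⟨ ℕ.*-monoʳ-≤ 2 m<n ⟩
  2 ℕ.* n            ≤⟨ ℕ.m≤m+n (2 ℕ.* n) ⟦ b′ ⟧ ⟩
  2 ℕ.* n ℕ.+ ⟦ b′ ⟧ ∎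
  where open ℕ.≤-Reasoning

-- Written like liftλ and liftκ, so that a threshold lifting is ⟦ toℕ i <ᵇ t ⟧ᶻ on the nose.
⟦_⟧ᶻ : Bool → ℤ
⟦ b ⟧ᶻ = if b then 1ℤ else 0ℤ

⟦⟧ᶻ≡+⟦⟧ : (b : Bool) → ⟦ b ⟧ᶻ ≡ + ⟦ b ⟧
⟦⟧ᶻ≡+⟦⟧ true  = refl
⟦⟧ᶻ≡+⟦⟧ false = refl

0≤⟦⟧ᶻ : (b : Bool) → 0ℤ ℤ.≤ ⟦ b ⟧ᶻ
0≤⟦⟧ᶻ true  = +≤+ z≤n
0≤⟦⟧ᶻ false = +≤+ z≤n

∣x∩x∣≡∣x∣ : (x : Vec Bool n) → ∣ x ∩ x ∣ ≡ ∣ x ∣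
∣x∩x∣≡∣x∣ []          = refl
∣x∩x∣≡∣x∣ (true  ∷ x) = cong suc (∣x∩x∣≡∣x∣ x)
∣x∩x∣≡∣x∣ (false ∷ x) = ∣x∩x∣≡∣x∣ x

∣x∩y∣≡∣x∣≡∣y∣⇒x≡y : (x y : Vec Bool n) → ∣ x ∩ y ∣ ≡ ∣ x ∣ → ∣ x ∩ y ∣ ≡ ∣ y ∣ → x ≡ y
∣x∩y∣≡∣x∣≡∣y∣⇒x≡y []          []          _ _ = refl
∣x∩y∣≡∣x∣≡∣y∣⇒x≡y (true  ∷ x) (true  ∷ y) p q =
  cong (true ∷_) (∣x∩y∣≡∣x∣≡∣y∣⇒x≡y x y (ℕ.suc-injective p) (ℕ.suc-injective q))
∣x∩y∣≡∣x∣≡∣y∣⇒x≡y (false ∷ x) (false ∷ y) p q = cong (false ∷_) (∣x∩y∣≡∣x∣≡∣y∣⇒x≡y x y p q)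
∣x∩y∣≡∣x∣≡∣y∣⇒x≡y (true  ∷ x) (false ∷ y) p _ =
  contradiction (subst (_≤ ∣ x ∣) p (∣p∩q∣≤∣p∣ x y)) ℕ.1+n≰n
∣x∩y∣≡∣x∣≡∣y∣⇒x≡y (false ∷ x) (true  ∷ y) _ q =
  contradiction (subst (_≤ ∣ y ∣) q (∣p∩q∣≤∣q∣ x y)) ℕ.1+n≰n

vector-of-weight : (j : ℕ) → j ≤ m → Σ[ p ∈ Vec Bool m ] ∣ p ∣ ≡ j
vector-of-weight {m} zero    _         = replicate m false , ∣⊥∣≡0 m
vector-of-weight     (suc j) (s≤s j≤m) with vector-of-weight j j≤m
... | p , ∣p∣≡j = true ∷ p , cong suc ∣p∣≡j

_≟ᵛ_ : DecidableEquality (Vec Bool n)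
_≟ᵛ_ = ≡-dec _≟ᵇ_

verts-weight : (k n : ℕ) → All (λ v → ∣ v ∣ ≡ k) (verts k n)
verts-weight zero    zero    = refl ∷ []
verts-weight (suc k) zero    = []
verts-weight zero    (suc n) = All.map⁺ (verts-weight zero n)
verts-weight (suc k) (suc n) =
  All.++⁺ (All.map⁺ (All.map (cong suc) (verts-weight k n))) (All.map⁺ (verts-weight (suc k) n))

verts-complete : (v : Vec Bool n) → v ∈ˡ verts ∣ v ∣ n
verts-complete []          = here refl
verts-complete (true  ∷ v) = ∈-++⁺ˡ (∈-map⁺ (true ∷_) (verts-complete v))
verts-complete (false ∷ v) with ∣ v ∣ | verts-complete v
... | zero  | v∈ = ∈-map⁺ (false ∷_) v∈
... | suc _ | v∈ = ∈-++⁺ʳ _ (∈-map⁺ (false ∷_) v∈)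

verts-unique : (k n : ℕ) → Unique (verts k n)
verts-unique zero    zero    = [] ∷ []
verts-unique (suc k) zero    = []
verts-unique zero    (suc n) = Unique.map⁺ ∷-injectiveʳ (verts-unique zero n)
verts-unique (suc k) (suc n) =
  Unique.++⁺ (Unique.map⁺ ∷-injectiveʳ (verts-unique k n))
             (Unique.map⁺ ∷-injectiveʳ (verts-unique (suc k) n)) heads-differ
  where
  heads-differ : {v : Vec Bool (suc n)} → v ∈ˡ map (true ∷_) (verts k n) × v ∈ˡ map (false ∷_) (verts (suc k) n) → ⊥
  heads-differ (p , q) with ∈-map⁻ (true ∷_) p | ∈-map⁻ (false ∷_) q
  ... | _ , _ , refl | _ , _ , ()

length-verts : (k n : ℕ) → N k n ≡ n C k
length-verts zero    zero    = refl
length-verts (suc k) zero    = refl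
length-verts zero    (suc n) = trans (length-map (false ∷_) (verts zero n)) (length-verts zero n)
length-verts (suc k) (suc n) = begin
  length (map (true ∷_) (verts k n) ++ map (false ∷_) (verts (suc k) n))
    ≡⟨ length-++ (map (true ∷_) (verts k n)) ⟩
  length (map (true ∷_) (verts k n)) ℕ.+ length (map (false ∷_) (verts (suc k) n))
    ≡⟨ cong₂ ℕ._+_ (trans (length-map _ (verts k n)) (length-verts k n))
                   (trans (length-map _ (verts (suc k) n)) (length-verts (suc k) n)) ⟩
  n C k ℕ.+ n C suc k
    ≡⟨ nCk+nC[k+1]≡[n+1]C[k+1] n k ⟩
  suc n C suc k ∎
  where open ≡-Reasoning

verts-zero : (n : ℕ) → verts 0 n ≡ replicate n false ∷ []
verts-zero zero    = refl
verts-zero (suc n) = cong (map (false ∷_)) (verts-zero n)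

HasLast : List A → Set
HasLast xs = ∃[ vs ] ∃[ w ] xs ≡ vs ∷ʳ w

HasLast-map : (f : A → B) {xs : List A} → HasLast xs → HasLast (map f xs)
HasLast-map f (vs , w , refl) = map f vs , f w , map-++ f vs _

HasLast-++ : {xs : List A} (ys : List A) → HasLast xs → HasLast (xs ++ ys)
HasLast-++ ys (vs , w , refl) with initLast ys
... | []       = vs , w , ++-identityʳ _
... | us ∷ʳ′ u = vs ∷ʳ w ++ us , u , sym (++-assoc (vs ∷ʳ w) us _)

verts-hasLast : k ≤ n → HasLast (verts k n)
verts-hasLast {zero}  {zero}  _         = [] , [] , refl
verts-hasLast {zero}  {suc n} _         = HasLast-map (false ∷_) (verts-hasLast {zero} {n} z≤n)
verts-hasLast {suc k} {suc n} (s≤s k≤n) = HasLast-++ _ (HasLast-map (true ∷_) (verts-hasLast k≤n))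

lookup-injective : {xs : List A} → Unique xs → {i j : Fin (length xs)} → lookup xs i ≡ lookup xs j → i ≡ j
lookup-injective {xs = _ ∷ _} _            {fzero}  {fzero}  _  = refl
lookup-injective {xs = _ ∷ _} (x∉ ∷ _)     {fzero}  {fsuc j} eq = contradiction eq (All.lookup x∉ (∈-lookup j))
lookup-injective {xs = _ ∷ _} (x∉ ∷ _)     {fsuc i} {fzero}  eq = contradiction (sym eq) (All.lookup x∉ (∈-lookup i))
lookup-injective {xs = _ ∷ _} (_ ∷ unique) {fsuc i} {fsuc j} eq = cong fsuc (lookup-injective unique eq)

vertex-weight : (k n : ℕ) (i : Fin (N k n)) → ∣ vertex k n i ∣ ≡ k
vertex-weight k n i = All.lookup (verts-weight k n) (∈-lookup i)

vertex-injective : (k n : ℕ) {i j : Fin (N k n)} → vertex k n i ≡ vertex k n j → i ≡ j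
vertex-injective k n = lookup-injective (verts-unique k n)

vertex-surjective : (v : Vec Bool n) → ∣ v ∣ ≡ k → ∃[ i ] vertex k n i ≡ v
vertex-surjective v refl = Any.index v∈ , sym (lookup-index v∈)
  where v∈ = verts-complete v

∣vertex∩vertex∣≤k : (k n : ℕ) (i j : Fin (N k n)) → ∣ vertex k n i ∩ vertex k n j ∣ ≤ k
∣vertex∩vertex∣≤k k n i j = subst (∣ vertex k n i ∩ vertex k n j ∣ ≤_) (vertex-weight k n i) (∣p∩q∣≤∣p∣ (vertex k n i) (vertex k n j))

∣vertex∩vertex∣≡k⇒≡ : (k n : ℕ) (i j : Fin (N k n)) → ∣ vertex k n i ∩ vertex k n j ∣ ≡ k → i ≡ j
∣vertex∩vertex∣≡k⇒≡ k n i j eq = vertex-injective k n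
  (∣x∩y∣≡∣x∣≡∣y∣⇒x≡y _ _ (trans eq (sym (vertex-weight k n i))) (trans eq (sym (vertex-weight k n j))))

∣vertex∩vertex∣<k : (k n : ℕ) (i j : Fin (N k n)) → i ≢ j → ∣ vertex k n i ∩ vertex k n j ∣ < k
∣vertex∩vertex∣<k k n i j i≢j = ℕ.≤∧≢⇒< (∣vertex∩vertex∣≤k k n i j) (i≢j ∘ ∣vertex∩vertex∣≡k⇒≡ k n i j)

∣vertex∩self∣≡k : (k n : ℕ) (i : Fin (N k n)) → ∣ vertex k n i ∩ vertex k n i ∣ ≡ k
∣vertex∩self∣≡k k n i = trans (∣x∩x∣≡∣x∣ (vertex k n i)) (vertex-weight k n i)

-- Threshold liftings

data SplitsAt (P : A → Bool) : ℕ → List A → Set where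
  none : {xs : List A} → All (λ x → P x ≡ false) xs → SplitsAt P 0 xs
  _∷_  : {x : A} {xs : List A} → P x ≡ true → SplitsAt P t xs → SplitsAt P (suc t) (x ∷ xs)

SplitsAt-lookup : {P : A → Bool} {xs : List A} → SplitsAt P t xs → (i : Fin (length xs)) →
                  (toℕ i <ᵇ t) ≡ P (lookup xs i)
SplitsAt-lookup (none (Px ∷ _))  fzero    = sym Px
SplitsAt-lookup (none (_ ∷ Pxs)) (fsuc i) = SplitsAt-lookup (none Pxs) i
SplitsAt-lookup (Px ∷ _)         fzero    = sym Px
SplitsAt-lookup (_ ∷ split)      (fsuc i) = SplitsAt-lookup split i

SplitsAt-map : {P : A → Bool} {Q : B → Bool} (f : A → B) → (∀ x → Q (f x) ≡ P x) →
               {xs : List A} → SplitsAt P t xs → SplitsAt Q t (map f xs)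
SplitsAt-map f Qf≡P (none Pxs)   = none (All.map⁺ (All.map (λ {x} Px → trans (Qf≡P x) Px) Pxs))
SplitsAt-map f Qf≡P (Px ∷ split) = trans (Qf≡P _) Px ∷ SplitsAt-map f Qf≡P split

SplitsAt-++ : {P : A → Bool} {xs ys : List A} → SplitsAt P t xs → All (λ y → P y ≡ false) ys →
              SplitsAt P t (xs ++ ys)
SplitsAt-++ (none Pxs)   Pys = none (All.++⁺ Pxs Pys)
SplitsAt-++ (Px ∷ split) Pys = Px ∷ SplitsAt-++ split Pys

SplitsAt-≢last : (_≟_ : DecidableEquality A) {vs : List A} {w : A} → Unique (vs ∷ʳ w) →
                 SplitsAt (λ v → not (does (v ≟ w))) (length vs) (vs ∷ʳ w)
SplitsAt-≢last _≟_ {[]}     {w} _             = none (cong not (dec-true (w ≟ w) refl) ∷ [])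
SplitsAt-≢last _≟_ {v ∷ vs} {w} (v∉ ∷ unique) =
  cong not (dec-false (v ≟ w) (All.lookup v∉ (∈-++⁺ʳ vs (here refl)))) ∷ SplitsAt-≢last _≟_ unique

record IsIndicatorOf (k n : ℕ) (ω : Lifting k n) (h : Vec Bool n → Bool) : Set where
  constructor isIndicatorOf
  field
    value : (i : Fin (N k n)) → ω i ≡ ⟦ h (vertex k n i) ⟧ᶻ

threshold-isIndicatorOf : {h : Vec Bool n → Bool} → SplitsAt h t (verts k n) →
                          IsIndicatorOf k n (λ i → ⟦ toℕ i <ᵇ t ⟧ᶻ) h
threshold-isIndicatorOf split = isIndicatorOf λ i → cong ⟦_⟧ᶻ (SplitsAt-lookup split i)

endsWithZero : Vec Bool n → Bool
endsWithZero []          = false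
endsWithZero (b ∷ [])    = not b
endsWithZero (_ ∷ c ∷ v) = endsWithZero (c ∷ v)

onesThenEndsWithZero : ℕ → Vec Bool n → Bool
onesThenEndsWithZero zero    v       = endsWithZero v
onesThenEndsWithZero (suc j) []      = false
onesThenEndsWithZero (suc j) (b ∷ v) = b ∧ onesThenEndsWithZero j v

endsWithZero-zeros : (n : ℕ) → endsWithZero (false ∷ replicate n false) ≡ true
endsWithZero-zeros zero    = refl
endsWithZero-zeros (suc n) = endsWithZero-zeros n

verts1-splitsAt : (n : ℕ) → SplitsAt endsWithZero n (verts 1 (suc n))
verts1-splitsAt zero                               = none (refl ∷ [])
verts1-splitsAt (suc n) rewrite verts-zero (suc n) =
  endsWithZero-zeros n ∷ SplitsAt-map (false ∷_) (λ { (_ ∷ _) → refl }) (verts1-splitsAt n)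

liftλ-splitsAt : (k n : ℕ) → SplitsAt (onesThenEndsWithZero k) (n ∸ suc k) (verts (suc k) n)
liftλ-splitsAt zero    zero    = none []
liftλ-splitsAt zero    (suc n) = verts1-splitsAt n
liftλ-splitsAt (suc k) zero    = none []
liftλ-splitsAt (suc k) (suc n) =
  SplitsAt-++ (SplitsAt-map (true ∷_) (λ _ → refl) (liftλ-splitsAt k n)) (All.map⁺ (All.universal (λ _ → refl) _))

liftλ-isIndicatorOf : (k n : ℕ) → IsIndicatorOf (suc k) n (liftλ (suc k) n) (onesThenEndsWithZero k)
liftλ-isIndicatorOf k n = threshold-isIndicatorOf {k = suc k} (liftλ-splitsAt k n)

startsWithOneExcept : Vec Bool n → Vec Bool (suc n) → Bool
startsWithOneExcept w (b ∷ v) = b ∧ not (does (v ≟ᵛ w))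

liftκ-isIndicatorOf : k ≤ n → ∃[ w ] ∣ w ∣ ≡ k × IsIndicatorOf (suc k) (suc n) (liftκ (suc k) (suc n)) (startsWithOneExcept w)
liftκ-isIndicatorOf {k} {n} k≤n with verts-hasLast k≤n
... | vs , w , verts≡ = w , All.lookup (verts-weight k n) w∈ ,
  subst (λ t → IsIndicatorOf (suc k) (suc n) (λ i → ⟦ toℕ i <ᵇ t ⟧ᶻ) (startsWithOneExcept w)) threshold
        (threshold-isIndicatorOf {k = suc k} split)
  where
  w∈ : w ∈ˡ verts k n
  w∈ = subst (w ∈ˡ_) (sym verts≡) (∈-++⁺ʳ vs (here refl))
  split : SplitsAt (startsWithOneExcept w) (length vs) (verts (suc k) (suc n))
  split = subst (λ xs → SplitsAt (startsWithOneExcept w) (length vs) (map (true ∷_) xs ++ map (false ∷_) (verts (suc k) n)))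
            (sym verts≡)
            (SplitsAt-++ (SplitsAt-map (true ∷_) (λ _ → refl) (SplitsAt-≢last _≟ᵛ_ (subst Unique verts≡ (verts-unique k n))))
                         (All.map⁺ (All.universal (λ _ → refl) _)))
  threshold : length vs ≡ n C k ∸ 1
  threshold = begin
    length vs                ≡⟨ ℕ.m+n∸n≡m (length vs) 1 ⟨
    length vs ℕ.+ 1 ∸ 1      ≡⟨ cong (_∸ 1) (length-++ vs) ⟨
    length (vs ∷ʳ w) ∸ 1     ≡⟨ cong (λ xs → length xs ∸ 1) verts≡ ⟨
    N k n ∸ 1                ≡⟨ cong (_∸ 1) (length-verts k n) ⟩
    n C k ∸ 1                ∎
    where open ≡-Reasoning

liftλ≡liftκ : (n : ℕ) → liftλ 2 n ≡ liftκ 2 n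
liftλ≡liftκ n = cong (λ t i → ⟦ toℕ i <ᵇ t ⟧ᶻ) (sym (trans (cong (_∸ 1) (nC1≡n (n ∸ 1))) (ℕ.∸-+-assoc n 1 1)))

-- Lower faces

indicator : Vec Bool n → Vec ℤ n
indicator = Vec.map ⟦_⟧ᶻ

dot-∷ : (c : ℤ) (cs : Vec ℤ n) (a : Bool) (x : Vec Bool n) → dot (c ∷ cs) (a ∷ x) ≡ c * ⟦ a ⟧ᶻ + dot cs x
dot-∷ c cs true  x = cong (_+ dot cs x) (sym (ℤ.*-identityʳ c))
dot-∷ c cs false x = sym (trans (cong (_+ dot cs x) (ℤ.*-zeroʳ c)) (ℤ.+-identityˡ (dot cs x)))

dot-indicator : (x v : Vec Bool n) → dot (indicator x) v ≡ + ∣ x ∩ v ∣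
dot-indicator []          []          = refl
dot-indicator (true  ∷ x) (true  ∷ v) = trans (cong (λ d → 1ℤ + d) (dot-indicator x v)) (sym (ℤ.pos-+ 1 ∣ x ∩ v ∣))
dot-indicator (false ∷ x) (true  ∷ v) = trans (ℤ.+-identityˡ _) (dot-indicator x v)
dot-indicator (true  ∷ x) (false ∷ v) = dot-indicator x v
dot-indicator (false ∷ x) (false ∷ v) = dot-indicator x v

dot-scale : (r : ℤ) (c : Vec ℤ n) (v : Vec Bool n) → dot (Vec.map (r *_) c) v ≡ r * dot c v
dot-scale r []       []          = sym (ℤ.*-zeroʳ r)
dot-scale r (c ∷ cs) (true  ∷ v) = trans (cong (λ d → r * c + d) (dot-scale r cs v)) (sym (ℤ.*-distribˡ-+ r c _))
dot-scale r (c ∷ cs) (false ∷ v) = dot-scale r cs v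

add-e₁ : ℕ → Vec ℤ (suc n) → Vec ℤ (suc n)
add-e₁ d (c ∷ cs) = (+ d + c) ∷ cs

dot-add-e₁ : (d : ℕ) (c : Vec ℤ (suc n)) (a : Bool) (v : Vec Bool n) →
             dot (add-e₁ d c) (a ∷ v) ≡ + (d ℕ.* ⟦ a ⟧) + dot c (a ∷ v)
dot-add-e₁ d (c ∷ cs) true  v =
  trans (ℤ.+-assoc (+ d) c (dot cs v)) (cong (λ m → + m + (c + dot cs v)) (sym (ℕ.*-identityʳ d)))
dot-add-e₁ d (c ∷ cs) false v =
  sym (trans (cong (λ m → + m + dot cs v) (ℕ.*-zeroʳ d)) (ℤ.+-identityˡ (dot cs v)))

lowerFace-of-maximizers : (k n : ℕ) (ω : Lifting k n) {E : Subset (N k n)} (c : Vec ℤ n) (c₀ : ℤ) → c₀ ℤ.< 0ℤ →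
                          (φ : Fin (N k n) → ℕ) (offset : ℤ) → (∀ i → dot c (vertex k n i) + c₀ * ω i ≡ + φ i + offset) →
                          {a : Fin (N k n)} → a ∈ E → (∀ i → i ∈ E → φ i ≡ φ a) → (∀ i → i ∈ E ⊎ φ i < φ a) →
                          IsLowerFace k n ω E
lowerFace-of-maximizers k n ω {E} c c₀ c₀<0 φ offset value {a} a∈E onE offE =
  c , c₀ , + φ a + offset , c₀<0 , (a , a∈E) , λ i → bounded i , mk⇔ (attained i) (onE′ i)
  where
  onE′ : ∀ i → i ∈ E → dot c (vertex k n i) + c₀ * ω i ≡ + φ a + offset
  onE′ i i∈E = trans (value i) (cong (λ m → + m + offset) (onE i i∈E))
  bounded : ∀ i → dot c (vertex k n i) + c₀ * ω i ℤ.≤ + φ a + offset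
  bounded i with offE i
  ... | inj₁ i∈E   = ℤ.≤-reflexive (onE′ i i∈E)
  ... | inj₂ φi<φa = subst (ℤ._≤ _) (sym (value i)) (ℤ.+-monoˡ-≤ offset (+≤+ (ℕ.<⇒≤ φi<φa)))
  attained : ∀ i → dot c (vertex k n i) + c₀ * ω i ≡ + φ a + offset → i ∈ E
  attained i eq with offE i
  ... | inj₁ i∈E   = i∈E
  ... | inj₂ φi<φa = contradiction (trans (sym (value i)) eq) (ℤ.<⇒≢ (ℤ.+-monoˡ-< offset (+<+ φi<φa)))

-- With c = 2x and c₀ = −1, leaving x costs at least 2 in ⟨c, v⟩ and gains at most 1 from ω.
singleton-lowerFace : {ω : Lifting k n} {h : Vec Bool n → Bool} → IsIndicatorOf k n ω h →
                      (x : Fin (N k n)) → IsLowerFace k n ω ⁅ x ⁆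
singleton-lowerFace {k} {n} {ω} {h} ω≡h x =
  lowerFace-of-maximizers k n ω c -1ℤ -<+ φ -1ℤ value (x∈⁅x⁆ x) onE offE
  where
  c : Vec ℤ n
  c = Vec.map (+ 2 *_) (indicator (vertex k n x))
  φ : Fin (N k n) → ℕ
  φ i = 2 ℕ.* ∣ vertex k n x ∩ vertex k n i ∣ ℕ.+ ⟦ not (h (vertex k n i)) ⟧
  -⟦b⟧ᶻ : ∀ b → -1ℤ * ⟦ b ⟧ᶻ ≡ + ⟦ not b ⟧ + -1ℤ
  -⟦b⟧ᶻ true  = refl
  -⟦b⟧ᶻ false = refl
  value : ∀ i → dot c (vertex k n i) + -1ℤ * ω i ≡ + φ i + -1ℤ
  value i = begin
    dot c v + -1ℤ * ω i
      ≡⟨ cong₂ _+_ (trans (dot-scale (+ 2) (indicator (vertex k n x)) v) (cong (+ 2 *_) (dot-indicator (vertex k n x) v)))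
                   (cong (λ w → -1ℤ * w) (IsIndicatorOf.value ω≡h i)) ⟩
    + 2 * + o + -1ℤ * ⟦ h v ⟧ᶻ
      ≡⟨ cong₂ _+_ (sym (ℤ.pos-* 2 o)) (-⟦b⟧ᶻ (h v)) ⟩
    + (2 ℕ.* o) + (+ ⟦ not (h v) ⟧ + -1ℤ)
      ≡⟨ ℤ.+-assoc (+ (2 ℕ.* o)) (+ ⟦ not (h v) ⟧) -1ℤ ⟨
    + (2 ℕ.* o) + + ⟦ not (h v) ⟧ + -1ℤ
      ≡⟨ cong (_+ -1ℤ) (ℤ.pos-+ (2 ℕ.* o) ⟦ not (h v) ⟧) ⟨
    + φ i + -1ℤ ∎
    where
    open ≡-Reasoning
    v = vertex k n i
    o = ∣ vertex k n x ∩ v ∣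
  onE : ∀ i → i ∈ ⁅ x ⁆ → φ i ≡ φ x
  onE i i∈ = cong φ (Equivalence.to x∈⁅y⁆⇔x≡y i∈)
  offE : ∀ i → i ∈ ⁅ x ⁆ ⊎ φ i < φ x
  offE i with i ≟ x
  ... | yes refl = inj₁ (x∈⁅x⁆ x)
  ... | no i≢x   = inj₂ (subst (λ m → φ i < 2 ℕ.* m ℕ.+ ⟦ not (h (vertex k n x)) ⟧) (sym (∣vertex∩self∣≡k k n x))
                          (2m+b<2n+b′ _ _ (∣vertex∩vertex∣<k k n x i (i≢x ∘ sym))))

data _⊕_≋_⊕_ : (x y u z : Vec Bool n) → Set where
  []  : [] ⊕ [] ≋ [] ⊕ []
  _∷_ : {a b c d : Bool} {x y u z : Vec Bool n} → ⟦ a ⟧ᶻ + ⟦ b ⟧ᶻ ≡ ⟦ c ⟧ᶻ + ⟦ d ⟧ᶻ →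
        x ⊕ y ≋ u ⊕ z → (a ∷ x) ⊕ (b ∷ y) ≋ (c ∷ u) ⊕ (d ∷ z)

⊕-refl : (x y : Vec Bool n) → x ⊕ y ≋ x ⊕ y
⊕-refl []      []      = []
⊕-refl (a ∷ x) (b ∷ y) = refl ∷ ⊕-refl x y

dot-⊕ : (c : Vec ℤ n) {x y u z : Vec Bool n} → x ⊕ y ≋ u ⊕ z → dot c x + dot c y ≡ dot c u + dot c z
dot-⊕ []       []                = refl
dot-⊕ (c ∷ cs) {a ∷ x} {b ∷ y} {e ∷ u} {f ∷ z} (ab≡ef ∷ xy≋uz) = begin
  dot (c ∷ cs) (a ∷ x) + dot (c ∷ cs) (b ∷ y)
    ≡⟨ cong₂ _+_ (dot-∷ c cs a x) (dot-∷ c cs b y) ⟩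
  (c * ⟦ a ⟧ᶻ + dot cs x) + (c * ⟦ b ⟧ᶻ + dot cs y)
    ≡⟨ regroup c ⟦ a ⟧ᶻ ⟦ b ⟧ᶻ (dot cs x) (dot cs y) ⟩
  c * (⟦ a ⟧ᶻ + ⟦ b ⟧ᶻ) + (dot cs x + dot cs y)
    ≡⟨ cong₂ (λ s t → c * s + t) ab≡ef (dot-⊕ cs xy≋uz) ⟩
  c * (⟦ e ⟧ᶻ + ⟦ f ⟧ᶻ) + (dot cs u + dot cs z)
    ≡⟨ regroup c ⟦ e ⟧ᶻ ⟦ f ⟧ᶻ (dot cs u) (dot cs z) ⟨
  (c * ⟦ e ⟧ᶻ + dot cs u) + (c * ⟦ f ⟧ᶻ + dot cs z)
    ≡⟨ cong₂ _+_ (dot-∷ c cs e u) (dot-∷ c cs f z) ⟨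
  dot (c ∷ cs) (e ∷ u) + dot (c ∷ cs) (f ∷ z) ∎
  where
  open ≡-Reasoning
  regroup : ∀ c p q s t → (c * p + s) + (c * q + t) ≡ c * (p + q) + (s + t)
  regroup = solve-∀

-- Additivity gives height a + height b ≤ height u + height z, and height z is at most the maximum.
lowerFace-exchange : {ω : Lifting k n} {E : Subset (N k n)} → IsLowerFace k n ω E →
                     {a b u z : Fin (N k n)} → a ∈ E → b ∈ E →
                     vertex k n a ⊕ vertex k n b ≋ vertex k n u ⊕ vertex k n z →
                     ω u + ω z ℤ.≤ ω a + ω b → u ∈ E
lowerFace-exchange {k} {n} {ω} {E} (c , c₀ , m , c₀<0 , _ , face) {a} {b} {u} {z} a∈E b∈E ab≋uz ωuz≤ωab =
  Equivalence.to (proj₂ (face u)) (ℤ.≤-antisym (proj₁ (face u)) (ℤ.≮⇒≥ u-not-below))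
  where
  height : Fin (N k n) → ℤ
  height i = dot c (vertex k n i) + c₀ * ω i
  on-face : ∀ {i} → i ∈ E → height i ≡ m
  on-face {i} i∈E = Equivalence.from (proj₂ (face i)) i∈E
  regroup : ∀ p q r s t → (p + r * s) + (q + r * t) ≡ (p + q) + r * (s + t)
  regroup = solve-∀
  instance
    c₀-nonPositive : ℤ.NonPositive c₀
    c₀-nonPositive = ℤ.nonPositive (ℤ.<⇒≤ c₀<0)
  exchange-≤ : height a + height b ℤ.≤ height u + height z
  exchange-≤ = begin
    height a + height b
      ≡⟨ regroup (dot c (vertex k n a)) (dot c (vertex k n b)) c₀ (ω a) (ω b) ⟩
    (dot c (vertex k n a) + dot c (vertex k n b)) + c₀ * (ω a + ω b)
      ≡⟨ cong (_+ c₀ * (ω a + ω b)) (dot-⊕ c ab≋uz) ⟩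
    (dot c (vertex k n u) + dot c (vertex k n z)) + c₀ * (ω a + ω b)
      ≤⟨ ℤ.+-monoʳ-≤ (dot c (vertex k n u) + dot c (vertex k n z)) (ℤ.*-monoˡ-≤-nonPos c₀ ωuz≤ωab) ⟩
    (dot c (vertex k n u) + dot c (vertex k n z)) + c₀ * (ω u + ω z)
      ≡⟨ regroup (dot c (vertex k n u)) (dot c (vertex k n z)) c₀ (ω u) (ω z) ⟨
    height u + height z ∎
    where open ℤ.≤-Reasoning
  u-not-below : ¬ (height u ℤ.< m)
  u-not-below hu<m = ℤ.<-irrefl refl (begin-strict
    m + m                ≡⟨ cong₂ _+_ (on-face a∈E) (on-face b∈E) ⟨
    height a + height b  ≤⟨ exchange-≤ ⟩
    height u + height z  <⟨ ℤ.+-mono-<-≤ hu<m (proj₁ (face z)) ⟩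
    m + m                ∎)
    where open ℤ.≤-Reasoning

-- Face posets and universal vertices

⁅x⁆⊆ : {x : Fin m} {F : Subset m} → x ∈ F → ⁅ x ⁆ ⊆ F
⁅x⁆⊆ {x = x} x∈F y∈⁅x⁆ = subst (_∈ _) (sym (x∈⁅y⁆⇒x≡y x y∈⁅x⁆)) x∈F

⁅⁆-injective : {x y : Fin m} → ⁅ x ⁆ ≡ ⁅ y ⁆ → x ≡ y
⁅⁆-injective {x = x} {y} eq = x∈⁅y⁆⇒x≡y y (subst (x ∈_) eq (x∈⁅x⁆ x))

⊆⁅x⁆⇒≡⁅x⁆ : {x : Fin m} {F : Subset m} → Nonempty F → F ⊆ ⁅ x ⁆ → F ≡ ⁅ x ⁆
⊆⁅x⁆⇒≡⁅x⁆ {x = x} (z , z∈F) F⊆x = ⊆-antisym F⊆x λ y∈⁅x⁆ →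
  subst (_∈ _) (trans (x∈⁅y⁆⇒x≡y x (F⊆x z∈F)) (sym (x∈⁅y⁆⇒x≡y x y∈⁅x⁆))) z∈F

∈⁅a⁆∪⁅b⁆⇔ : {a b x : Fin m} → x ∈ ⁅ a ⁆ ∪ ⁅ b ⁆ ⇔ (x ≡ a ⊎ x ≡ b)
∈⁅a⁆∪⁅b⁆⇔ {a = a} {b} = mk⇔
  (Sum.map (x∈⁅y⁆⇒x≡y a) (x∈⁅y⁆⇒x≡y b) ∘ x∈p∪q⁻ ⁅ a ⁆ ⁅ b ⁆)
  (x∈p∪q⁺ ∘ Sum.map (λ { refl → x∈⁅x⁆ a }) (λ { refl → x∈⁅x⁆ b }))

record FaceIso (L L′ : Subset m → Set) : Set where
  field
    to        : Subset m → Subset m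
    from      : Subset m → Subset m
    to-face   : {F : Subset m} → L F → L′ (to F)
    from-face : {G : Subset m} → L′ G → L (from G)
    from∘to   : {F : Subset m} → L F → from (to F) ≡ F
    to∘from   : {G : Subset m} → L′ G → to (from G) ≡ G
    to-⊆⇔     : {F G : Subset m} → L F → L G → F ⊆ G ⇔ to F ⊆ to G

FaceIso-sym : {L L′ : Subset m → Set} → FaceIso L L′ → FaceIso L′ L
FaceIso-sym iso = record
  { to        = from
  ; from      = to
  ; to-face   = from-face
  ; from-face = to-face
  ; from∘to   = to∘from
  ; to∘from   = from∘to
  ; to-⊆⇔     = λ LG LH → mk⇔
      (Equivalence.from (to-⊆⇔ (from-face LG) (from-face LH)) ∘ subst₂ _⊆_ (sym (to∘from LG)) (sym (to∘from LH)))
      (subst₂ _⊆_ (to∘from LG) (to∘from LH) ∘ Equivalence.to (to-⊆⇔ (from-face LG) (from-face LH)))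
  }
  where open FaceIso iso

CombIsomorphic⇒FaceIso : {ω ω′ : Lifting k n} → CombIsomorphic k n ω ω′ →
                          FaceIso (IsLowerFace k n ω) (IsLowerFace k n ω′)
CombIsomorphic⇒FaceIso (f , g , f-face , g-face , g∘f , f∘g , f-⊆⇔) = record
  { to = f ; from = g ; to-face = f-face _ ; from-face = g-face _
  ; from∘to = g∘f _ ; to∘from = f∘g _ ; to-⊆⇔ = f-⊆⇔ _ _ }

CombIsomorphic-refl : (k n : ℕ) (ω : Lifting k n) → CombIsomorphic k n ω ω
CombIsomorphic-refl k n ω = id , id , (λ _ → id) , (λ _ → id) , (λ _ _ → refl) , (λ _ _ → refl) , λ _ _ _ _ → mk⇔ id id

record IsFaceFamily (L : Subset m → Set) : Set where
  field
    singleton : (x : Fin m) → L ⁅ x ⁆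
    nonempty  : {F : Subset m} → L F → Nonempty F

lowerFaces-isFaceFamily : {ω : Lifting k n} {h : Vec Bool n → Bool} → IsIndicatorOf k n ω h →
                          IsFaceFamily (IsLowerFace k n ω)
lowerFaces-isFaceFamily ω≡h = record
  { singleton = singleton-lowerFace ω≡h
  ; nonempty  = λ (_ , _ , _ , _ , nonempty , _) → nonempty }

Adjacent : (L : Subset m → Set) → Fin m → Fin m → Set
Adjacent L a b = L (⁅ a ⁆ ∪ ⁅ b ⁆)

HasUniversalVertex : (L : Subset m → Set) → Set
HasUniversalVertex {m} L = ∃[ a ] ((b : Fin m) → Adjacent L a b)

singleton-image : {L L′ : Subset m → Set} → IsFaceFamily L → IsFaceFamily L′ →
                  (iso : FaceIso L L′) (x : Fin m) → ∃[ y ] FaceIso.to iso ⁅ x ⁆ ≡ ⁅ y ⁆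
singleton-image L-faces L′-faces iso x with IsFaceFamily.nonempty L′-faces (FaceIso.to-face iso (IsFaceFamily.singleton L-faces x))
... | y , y∈to⁅x⁆ = y , (begin
  to ⁅ x ⁆          ≡⟨ cong to from⁅y⁆≡⁅x⁆ ⟨
  to (from ⁅ y ⁆)   ≡⟨ to∘from (singleton L′-faces y) ⟩
  ⁅ y ⁆             ∎)
  where
  open ≡-Reasoning
  open FaceIso iso
  open IsFaceFamily
  from⁅y⁆⊆⁅x⁆ : from ⁅ y ⁆ ⊆ ⁅ x ⁆
  from⁅y⁆⊆⁅x⁆ = subst (from ⁅ y ⁆ ⊆_) (from∘to (singleton L-faces x))
    (Equivalence.to (FaceIso.to-⊆⇔ (FaceIso-sym iso) (singleton L′-faces y) (to-face (singleton L-faces x)))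
      (⁅x⁆⊆ y∈to⁅x⁆))
  from⁅y⁆≡⁅x⁆ : from ⁅ y ⁆ ≡ ⁅ x ⁆
  from⁅y⁆≡⁅x⁆ = ⊆⁅x⁆⇒≡⁅x⁆ (nonempty L-faces (from-face (singleton L′-faces y))) from⁅y⁆⊆⁅x⁆

module VertexMap {L L′ : Subset m → Set} (L-faces : IsFaceFamily L) (L′-faces : IsFaceFamily L′)
                 (iso : FaceIso L L′) where
  open FaceIso iso
  open IsFaceFamily

  σ : Fin m → Fin m
  σ x = proj₁ (singleton-image L-faces L′-faces iso x)

  to⁅x⁆≡⁅σx⁆ : (x : Fin m) → to ⁅ x ⁆ ≡ ⁅ σ x ⁆
  to⁅x⁆≡⁅σx⁆ x = proj₂ (singleton-image L-faces L′-faces iso x)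

  ∈⇔σ∈ : {F : Subset m} → L F → {x : Fin m} → x ∈ F ⇔ σ x ∈ to F
  ∈⇔σ∈ LF {x} = mk⇔
    (λ x∈F → Equivalence.to (to-⊆⇔ (singleton L-faces x) LF) (⁅x⁆⊆ x∈F) σx∈to⁅x⁆)
    (λ σx∈F → Equivalence.from (to-⊆⇔ (singleton L-faces x) LF)
                (subst (_⊆ to _) (sym (to⁅x⁆≡⁅σx⁆ x)) (⁅x⁆⊆ σx∈F)) (x∈⁅x⁆ x))
    where
    σx∈to⁅x⁆ : σ x ∈ to ⁅ x ⁆
    σx∈to⁅x⁆ = subst (σ x ∈_) (sym (to⁅x⁆≡⁅σx⁆ x)) (x∈⁅x⁆ (σ x))

  σ-injective : {x y : Fin m} → σ x ≡ σ y → x ≡ y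
  σ-injective {x} {y} eq = ⁅⁆-injective (begin
    ⁅ x ⁆             ≡⟨ from∘to (singleton L-faces x) ⟨
    from (to ⁅ x ⁆)   ≡⟨ cong from (trans (to⁅x⁆≡⁅σx⁆ x) (trans (cong ⁅_⁆ eq) (sym (to⁅x⁆≡⁅σx⁆ y)))) ⟩
    from (to ⁅ y ⁆)   ≡⟨ from∘to (singleton L-faces y) ⟩
    ⁅ y ⁆             ∎)
    where open ≡-Reasoning

  σ-surjective : (y : Fin m) → ∃[ x ] σ x ≡ y
  σ-surjective y with singleton-image L′-faces L-faces (FaceIso-sym iso) y
  ... | x , from⁅y⁆≡⁅x⁆ = x , ⁅⁆-injective (begin
    ⁅ σ x ⁆           ≡⟨ to⁅x⁆≡⁅σx⁆ x ⟨
    to ⁅ x ⁆          ≡⟨ cong to from⁅y⁆≡⁅x⁆ ⟨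
    to (from ⁅ y ⁆)   ≡⟨ to∘from (singleton L′-faces y) ⟩
    ⁅ y ⁆             ∎)
    where open ≡-Reasoning

  from-adjacent : {a b : Fin m} → Adjacent L′ (σ a) (σ b) → from (⁅ σ a ⁆ ∪ ⁅ σ b ⁆) ≡ ⁅ a ⁆ ∪ ⁅ b ⁆
  from-adjacent {a} {b} adj = ⊆-antisym
    (Equivalence.from ∈⁅a⁆∪⁅b⁆⇔ ∘ Sum.map σ-injective σ-injective ∘ Equivalence.to ∈⁅a⁆∪⁅b⁆⇔
      ∘ subst (_ ∈_) (to∘from adj) ∘ Equivalence.to (∈⇔σ∈ (from-face adj)))
    (Equivalence.from (∈⇔σ∈ (from-face adj)) ∘ subst (_ ∈_) (sym (to∘from adj))
      ∘ Equivalence.from ∈⁅a⁆∪⁅b⁆⇔ ∘ Sum.map (cong σ) (cong σ) ∘ Equivalence.to ∈⁅a⁆∪⁅b⁆⇔)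

  HasUniversalVertex-reflect : HasUniversalVertex L′ → HasUniversalVertex L
  HasUniversalVertex-reflect (a′ , a′-adjacent) with σ-surjective a′
  ... | a , refl = a , λ b → subst L (from-adjacent (a′-adjacent (σ b))) (from-face (a′-adjacent (σ b)))

-- The κ-subdivision

d[p+q]+y-dq≡dp+y : (d p q y : ℕ) → + (d ℕ.* (p ℕ.+ q)) + + y + - (+ d) * + q ≡ + (d ℕ.* p ℕ.+ y)
d[p+q]+y-dq≡dp+y d p q y = begin
  + (d ℕ.* (p ℕ.+ q)) + + y + - (+ d) * + q
    ≡⟨ cong (λ t → t + + y + - (+ d) * + q) (trans (ℤ.pos-* d (p ℕ.+ q)) (cong (+ d *_) (ℤ.pos-+ p q))) ⟩
  + d * (+ p + + q) + + y + - (+ d) * + q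
    ≡⟨ cancel (+ d) (+ p) (+ q) (+ y) ⟩
  + d * + p + + y
    ≡⟨ cong (_+ + y) (ℤ.pos-* d p) ⟨
  + (d ℕ.* p) + + y
    ≡⟨ ℤ.pos-+ (d ℕ.* p) y ⟨
  + (d ℕ.* p ℕ.+ y) ∎
  where
  open ≡-Reasoning
  cancel : ∀ D P Q Y → D * (P + Q) + Y + - D * Q ≡ D * P + Y
  cancel = solve-∀

module _ (w : Vec Bool n) where

  equals1∷ : Vec Bool (suc n) → Bool
  equals1∷ (a ∷ v) = a ∧ does (v ≟ᵛ w)

  ⟦head⟧-split : (a : Bool) (v : Vec Bool n) → ⟦ a ⟧ ≡ ⟦ equals1∷ (a ∷ v) ⟧ ℕ.+ ⟦ startsWithOneExcept w (a ∷ v) ⟧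
  ⟦head⟧-split false v = refl
  ⟦head⟧-split true  v with does (v ≟ᵛ w)
  ... | true  = refl
  ... | false = refl

  equals1∷-self : equals1∷ (true ∷ w) ≡ true
  equals1∷-self = dec-true (w ≟ᵛ w) refl

  equals1∷-other : {v : Vec Bool (suc n)} → v ≢ true ∷ w → equals1∷ v ≡ false
  equals1∷-other {false ∷ v} _   = refl
  equals1∷-other {true  ∷ v} v≢w = dec-false (v ≟ᵛ w) (v≢w ∘ cong (true ∷_))

  add-e₁-height : (d : ℕ) (y v : Vec Bool (suc n)) →
                  dot (add-e₁ d (indicator y)) v + - (+ d) * ⟦ startsWithOneExcept w v ⟧ᶻ ≡ + (d ℕ.* ⟦ equals1∷ v ⟧ ℕ.+ ∣ y ∩ v ∣)
  add-e₁-height d y (a ∷ v) = begin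
    dot (add-e₁ d (indicator y)) (a ∷ v) + - (+ d) * ⟦ s ⟧ᶻ
      ≡⟨ cong₂ _+_ (trans (dot-add-e₁ d (indicator y) a v) (cong (λ t → + (d ℕ.* ⟦ a ⟧) + t) (dot-indicator y (a ∷ v))))
                   (cong (λ t → - (+ d) * t) (⟦⟧ᶻ≡+⟦⟧ s)) ⟩
    + (d ℕ.* ⟦ a ⟧) + + ∣ y ∩ (a ∷ v) ∣ + - (+ d) * + ⟦ s ⟧
      ≡⟨ cong (λ t → + (d ℕ.* t) + + ∣ y ∩ (a ∷ v) ∣ + - (+ d) * + ⟦ s ⟧) (⟦head⟧-split a v) ⟩
    + (d ℕ.* (⟦ equals1∷ (a ∷ v) ⟧ ℕ.+ ⟦ s ⟧)) + + ∣ y ∩ (a ∷ v) ∣ + - (+ d) * + ⟦ s ⟧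
      ≡⟨ d[p+q]+y-dq≡dp+y d ⟦ equals1∷ (a ∷ v) ⟧ ⟦ s ⟧ ∣ y ∩ (a ∷ v) ∣ ⟩
    + (d ℕ.* ⟦ equals1∷ (a ∷ v) ⟧ ℕ.+ ∣ y ∩ (a ∷ v) ∣) ∎
    where
    open ≡-Reasoning
    s = startsWithOneExcept w (a ∷ v)

module _ {k n : ℕ} {ω : Lifting k (suc n)} {w : Vec Bool n}
         (ω≡ : IsIndicatorOf k (suc n) ω (startsWithOneExcept w))
         {c : Fin (N k (suc n))} (vertex-c : vertex k (suc n) c ≡ true ∷ w) where

  private
    L = IsLowerFace k (suc n) ω
    vertex-other : {i : Fin (N k (suc n))} → i ≢ c → vertex k (suc n) i ≢ true ∷ w
    vertex-other i≢c eq = i≢c (vertex-injective k (suc n) (trans eq (sym vertex-c)))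

  edge-lowerFace : {b : Fin (N k (suc n))} → b ≢ c → L (⁅ c ⁆ ∪ ⁅ b ⁆)
  edge-lowerFace {b} b≢c with ℕ.m≤n⇒∃[o]m+o≡n (∣vertex∩vertex∣<k k (suc n) b c b≢c)
  ... | d , 1+o+d≡k =
    lowerFace-of-maximizers k (suc n) ω c′ (- (+ suc d)) -<+ φ 0ℤ value
      (Equivalence.from ∈⁅a⁆∪⁅b⁆⇔ (inj₁ refl)) on-edge off-edge
    where
    y = vertex k (suc n) b
    o = ∣ y ∩ vertex k (suc n) c ∣
    c′ : Vec ℤ (suc n)
    c′ = add-e₁ (suc d) (indicator y)
    φ : Fin (N k (suc n)) → ℕ
    φ i = suc d ℕ.* ⟦ equals1∷ w (vertex k (suc n) i) ⟧ ℕ.+ ∣ y ∩ vertex k (suc n) i ∣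
    value : ∀ i → dot c′ (vertex k (suc n) i) + - (+ suc d) * ω i ≡ + φ i + 0ℤ
    value i = trans (cong (λ t → dot c′ (vertex k (suc n) i) + - (+ suc d) * t) (IsIndicatorOf.value ω≡ i))
                    (trans (add-e₁-height w (suc d) y (vertex k (suc n) i)) (sym (ℤ.+-identityʳ (+ φ i))))
    φ-c : φ c ≡ k
    φ-c = begin
      suc d ℕ.* ⟦ equals1∷ w (vertex k (suc n) c) ⟧ ℕ.+ o
        ≡⟨ cong (λ v → suc d ℕ.* ⟦ equals1∷ w v ⟧ ℕ.+ o) vertex-c ⟩
      suc d ℕ.* ⟦ equals1∷ w (true ∷ w) ⟧ ℕ.+ o
        ≡⟨ cong (λ e → suc d ℕ.* ⟦ e ⟧ ℕ.+ o) (equals1∷-self w) ⟩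
      suc d ℕ.* 1 ℕ.+ o
        ≡⟨ cong (ℕ._+ o) (ℕ.*-identityʳ (suc d)) ⟩
      suc d ℕ.+ o
        ≡⟨ ℕ.+-comm (suc d) o ⟩
      o ℕ.+ suc d
        ≡⟨ ℕ.+-suc o d ⟩
      suc o ℕ.+ d
        ≡⟨ 1+o+d≡k ⟩
      k ∎
      where open ≡-Reasoning
    φ-other : ∀ {i} → i ≢ c → φ i ≡ ∣ y ∩ vertex k (suc n) i ∣
    φ-other {i} i≢c =
      trans (cong (λ e → suc d ℕ.* ⟦ e ⟧ ℕ.+ ∣ y ∩ vertex k (suc n) i ∣) (equals1∷-other w (vertex-other i≢c)))
            (cong (ℕ._+ ∣ y ∩ vertex k (suc n) i ∣) (ℕ.*-zeroʳ (suc d)))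
    on-edge : ∀ i → i ∈ ⁅ c ⁆ ∪ ⁅ b ⁆ → φ i ≡ φ c
    on-edge i i∈ with Equivalence.to ∈⁅a⁆∪⁅b⁆⇔ i∈
    ... | inj₁ refl = refl
    ... | inj₂ refl = trans (φ-other b≢c) (trans (∣vertex∩self∣≡k k (suc n) b) (sym φ-c))
    off-edge : ∀ i → i ∈ ⁅ c ⁆ ∪ ⁅ b ⁆ ⊎ φ i < φ c
    off-edge i with i ≟ c | i ≟ b
    ... | yes i≡c | _       = inj₁ (Equivalence.from ∈⁅a⁆∪⁅b⁆⇔ (inj₁ i≡c))
    ... | no _    | yes i≡b = inj₁ (Equivalence.from ∈⁅a⁆∪⁅b⁆⇔ (inj₂ i≡b))
    ... | no i≢c  | no i≢b  = inj₂ (subst₂ _<_ (sym (φ-other i≢c)) (sym φ-c)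
                                     (∣vertex∩vertex∣<k k (suc n) b i (i≢b ∘ sym)))

  universal-vertex : (b : Fin (N k (suc n))) → Adjacent L c b
  universal-vertex b with b ≟ c
  ... | yes refl = subst L (sym (∪-idem ⁅ c ⁆)) (singleton-lowerFace ω≡ c)
  ... | no b≢c   = edge-lowerFace b≢c

liftκ-hasUniversalVertex : k ≤ n → HasUniversalVertex (IsLowerFace (suc k) (suc n) (liftκ (suc k) (suc n)))
liftκ-hasUniversalVertex k≤n with liftκ-isIndicatorOf k≤n
... | w , ∣w∣≡k , ω≡ with vertex-surjective (true ∷ w) (cong suc ∣w∣≡k)
... | c , vertex-c = c , universal-vertex ω≡ vertex-c

-- The λ-subdivision

add-two : (r : Vec Bool m) → 2 ℕ.+ ∣ r ∣ ≤ m →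
          ∃[ r′ ] ∃[ s ] ∃[ t ] r ⊕ r′ ≋ s ⊕ t × ∣ r′ ∣ ≡ 2 ℕ.+ ∣ r ∣ × ∣ s ∣ ≡ 1 ℕ.+ ∣ r ∣ × ∣ t ∣ ≡ 1 ℕ.+ ∣ r ∣
add-two (true ∷ r) (s≤s 2+∣r∣≤m) with add-two r 2+∣r∣≤m
... | r′ , s , t , r+r′≋s+t , ∣r′∣ , ∣s∣ , ∣t∣ =
  true ∷ r′ , true ∷ s , true ∷ t , refl ∷ r+r′≋s+t , cong suc ∣r′∣ , cong suc ∣s∣ , cong suc ∣t∣
add-two {suc m} (false ∷ r) (s≤s 1+∣r∣≤m) with vector-of-weight (suc ∣ r ∣) 1+∣r∣≤m
... | p , ∣p∣ = true ∷ p , true ∷ r , false ∷ p , refl ∷ ⊕-refl r p , cong suc ∣p∣ , refl , ∣p∣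

remove-two : (r : Vec Bool m) → 2 ≤ ∣ r ∣ →
             ∃[ r′ ] ∃[ s ] ∃[ t ] r ⊕ r′ ≋ s ⊕ t × 2 ℕ.+ ∣ r′ ∣ ≡ ∣ r ∣ × 1 ℕ.+ ∣ s ∣ ≡ ∣ r ∣ × 1 ℕ.+ ∣ t ∣ ≡ ∣ r ∣
remove-two (false ∷ r) 2≤∣r∣ with remove-two r 2≤∣r∣
... | r′ , s , t , r+r′≋s+t , ∣r′∣ , ∣s∣ , ∣t∣ =
  false ∷ r′ , false ∷ s , false ∷ t , refl ∷ r+r′≋s+t , ∣r′∣ , ∣s∣ , ∣t∣
remove-two {suc m} (true ∷ r) 2≤1+∣r∣ with ∣ r ∣ in ∣r∣≡ | 2≤1+∣r∣
... | zero  | s≤s ()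
... | suc j | _ with vector-of-weight j (ℕ.<⇒≤ (subst (_≤ m) ∣r∣≡ (∣p∣≤n r)))
... | p , ∣p∣ = false ∷ p , false ∷ r , true ∷ p , refl ∷ ⊕-refl r p ,
                cong (2 ℕ.+_) ∣p∣ , cong suc ∣r∣≡ , cong (2 ℕ.+_) ∣p∣

other-of-same-weight : (r : Vec Bool m) → 1 ≤ ∣ r ∣ → ∣ r ∣ < m → Σ[ p ∈ Vec Bool m ] p ≢ r × ∣ p ∣ ≡ ∣ r ∣
other-of-same-weight {suc m} (false ∷ r) 1≤∣r∣ _ with ∣ r ∣ in ∣r∣≡ | 1≤∣r∣
... | zero  | ()
... | suc j | _ with vector-of-weight j (ℕ.<⇒≤ (subst (_≤ m) ∣r∣≡ (∣p∣≤n r)))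
... | q , ∣q∣ = true ∷ q , (λ ()) , cong suc ∣q∣
other-of-same-weight {suc m} (true ∷ r) _ (s≤s ∣r∣<m) with vector-of-weight (suc ∣ r ∣) ∣r∣<m
... | q , ∣q∣ = false ∷ q , (λ ()) , ∣q∣

record Exchange (x : Vec Bool (suc (suc m))) : Set where
  field
    y u z   : Vec Bool (suc (suc m))
    ∣y∣≡∣x∣ : ∣ y ∣ ≡ ∣ x ∣
    ∣u∣≡∣x∣ : ∣ u ∣ ≡ ∣ x ∣
    ∣z∣≡∣x∣ : ∣ z ∣ ≡ ∣ x ∣
    x+y≋u+z : x ⊕ y ≋ u ⊕ z
    u-split : head u ∧ head (tail u) ≡ false
    z-split : head z ∧ head (tail z) ≡ false
    u≢x     : u ≢ x
    u≢y     : u ≢ y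

exchange : (x : Vec Bool (suc (suc m))) → 2 ≤ ∣ x ∣ → ∣ x ∣ ≤ m → Exchange x
exchange (true ∷ true ∷ r) _ ∣x∣≤m with add-two r ∣x∣≤m
... | r′ , s , t , r+r′≋s+t , ∣r′∣ , ∣s∣ , ∣t∣ = record
  { y = false ∷ false ∷ r′ ; u = false ∷ true ∷ s ; z = true ∷ false ∷ t
  ; ∣y∣≡∣x∣ = ∣r′∣ ; ∣u∣≡∣x∣ = cong suc ∣s∣ ; ∣z∣≡∣x∣ = cong suc ∣t∣
  ; x+y≋u+z = refl ∷ refl ∷ r+r′≋s+t
  ; u-split = refl ; z-split = refl ; u≢x = λ () ; u≢y = λ ()
  }
exchange (false ∷ false ∷ r) 2≤∣r∣ _ with remove-two r 2≤∣r∣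
... | r′ , s , t , r+r′≋s+t , ∣r′∣ , ∣s∣ , ∣t∣ = record
  { y = true ∷ true ∷ r′ ; u = true ∷ false ∷ s ; z = false ∷ true ∷ t
  ; ∣y∣≡∣x∣ = ∣r′∣ ; ∣u∣≡∣x∣ = ∣s∣ ; ∣z∣≡∣x∣ = ∣t∣
  ; x+y≋u+z = refl ∷ refl ∷ r+r′≋s+t
  ; u-split = refl ; z-split = refl ; u≢x = λ () ; u≢y = λ ()
  }
exchange (false ∷ true ∷ r) (s≤s 1≤∣r∣) ∣r∣<m with other-of-same-weight r 1≤∣r∣ ∣r∣<m
... | p , p≢r , ∣p∣ = record
  { y = true ∷ false ∷ p ; u = true ∷ false ∷ r ; z = false ∷ true ∷ p
  ; ∣y∣≡∣x∣ = cong suc ∣p∣ ; ∣u∣≡∣x∣ = refl ; ∣z∣≡∣x∣ = cong suc ∣p∣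
  ; x+y≋u+z = refl ∷ refl ∷ ⊕-refl r p
  ; u-split = refl ; z-split = refl ; u≢x = λ () ; u≢y = p≢r ∘ sym ∘ ∷-injectiveʳ ∘ ∷-injectiveʳ
  }
exchange (true ∷ false ∷ r) (s≤s 1≤∣r∣) ∣r∣<m with other-of-same-weight r 1≤∣r∣ ∣r∣<m
... | p , p≢r , ∣p∣ = record
  { y = false ∷ true ∷ p ; u = false ∷ true ∷ r ; z = true ∷ false ∷ p
  ; ∣y∣≡∣x∣ = cong suc ∣p∣ ; ∣u∣≡∣x∣ = refl ; ∣z∣≡∣x∣ = cong suc ∣p∣
  ; x+y≋u+z = refl ∷ refl ∷ ⊕-refl r p
  ; u-split = refl ; z-split = refl ; u≢x = λ () ; u≢y = p≢r ∘ sym ∘ ∷-injectiveʳ ∘ ∷-injectiveʳ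
  }

¬adjacent-by-exchange : {ω : Lifting k n} {a b u z : Fin (N k n)} →
                        vertex k n a ⊕ vertex k n b ≋ vertex k n u ⊕ vertex k n z →
                        ω u + ω z ℤ.≤ ω a + ω b → u ≢ a → u ≢ b → ¬ Adjacent (IsLowerFace k n ω) a b
¬adjacent-by-exchange {k} {n} {ω} a+b≋u+z ω-decreases u≢a u≢b face =
  [ u≢a , u≢b ] (Equivalence.to ∈⁅a⁆∪⁅b⁆⇔
    (lowerFace-exchange {k = k} {n} {ω} face (Equivalence.from ∈⁅a⁆∪⁅b⁆⇔ (inj₁ refl))
                        (Equivalence.from ∈⁅a⁆∪⁅b⁆⇔ (inj₂ refl)) a+b≋u+z ω-decreases))

onesThenEndsWithZero-split : (j : ℕ) (v : Vec Bool (suc (suc m))) → head v ∧ head (tail v) ≡ false →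
                             onesThenEndsWithZero (suc (suc j)) v ≡ false
onesThenEndsWithZero-split j (false ∷ _     ∷ _) _ = refl
onesThenEndsWithZero-split j (true  ∷ false ∷ _) _ = refl

module _ {k m : ℕ} {ω : Lifting k (suc (suc m))} {h : Vec Bool (suc (suc m)) → Bool}
         (ω≡h : IsIndicatorOf k (suc (suc m)) ω h)
         (h-vanishes : ∀ v → head v ∧ head (tail v) ≡ false → h v ≡ false) where

  nonadjacent-partner : (a : Fin (N k (suc (suc m)))) → Exchange (vertex k (suc (suc m)) a) →
                        ∃[ b ] ¬ Adjacent (IsLowerFace k (suc (suc m)) ω) a b
  nonadjacent-partner a record { y = y ; u = u ; z = z ; ∣y∣≡∣x∣ = ∣y∣ ; ∣u∣≡∣x∣ = ∣u∣ ; ∣z∣≡∣x∣ = ∣z∣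
                               ; x+y≋u+z = x+y≋u+z ; u-split = u-split ; z-split = z-split ; u≢x = u≢x ; u≢y = u≢y }
    with vertex-surjective y (trans ∣y∣ ∣x∣≡k) | vertex-surjective u (trans ∣u∣ ∣x∣≡k) | vertex-surjective z (trans ∣z∣ ∣x∣≡k)
    where ∣x∣≡k = vertex-weight k (suc (suc m)) a
  ... | b , refl | iu , refl | iz , refl =
    b , ¬adjacent-by-exchange {k = k} {suc (suc m)} {ω} {a} {b} {iu} {iz} x+y≋u+z ω-decreases
          (u≢x ∘ cong (vertex k (suc (suc m)))) (u≢y ∘ cong (vertex k (suc (suc m))))
    where
    ω-vanishes : ∀ i → head (vertex k (suc (suc m)) i) ∧ head (tail (vertex k (suc (suc m)) i)) ≡ false → ω i ≡ 0ℤ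
    ω-vanishes i split = trans (IsIndicatorOf.value ω≡h i) (cong ⟦_⟧ᶻ (h-vanishes _ split))
    ω-nonneg : ∀ i → 0ℤ ℤ.≤ ω i
    ω-nonneg i = subst (0ℤ ℤ.≤_) (sym (IsIndicatorOf.value ω≡h i)) (0≤⟦⟧ᶻ _)
    ω-decreases : ω iu + ω iz ℤ.≤ ω a + ω b
    ω-decreases = subst₂ (λ p q → p + q ℤ.≤ ω a + ω b) (sym (ω-vanishes iu u-split)) (sym (ω-vanishes iz z-split))
                         (ℤ.+-mono-≤ (ω-nonneg a) (ω-nonneg b))

  ¬hasUniversalVertex : 2 ≤ k → k ≤ m → ¬ HasUniversalVertex (IsLowerFace k (suc (suc m)) ω)
  ¬hasUniversalVertex 2≤k k≤m (a , adjacent)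
    with nonadjacent-partner a (exchange (vertex k (suc (suc m)) a) (subst (2 ≤_) (sym ∣x∣≡k) 2≤k) (subst (_≤ m) (sym ∣x∣≡k) k≤m))
    where ∣x∣≡k = vertex-weight k (suc (suc m)) a
  ... | b , ¬adjacent = ¬adjacent (adjacent b)

corollary4p12 : (k n : ℕ) → 2 ≤ k → k ≤ n ∸ 2 →
    CombIsomorphic k n (liftλ k n) (liftκ k n) ⇔ (k ≡ 2)
corollary4p12 k n 2≤k k≤n∸2 = mk⇔ (isomorphic⇒k≡2 k n 2≤k k≤n∸2) λ { refl → isomorphic-at-2 }
  where
  isomorphic-at-2 : CombIsomorphic 2 n (liftλ 2 n) (liftκ 2 n)
  isomorphic-at-2 = subst (CombIsomorphic 2 n (liftλ 2 n)) (liftλ≡liftκ n) (CombIsomorphic-refl 2 n (liftλ 2 n))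
  isomorphic⇒k≡2 : ∀ k n → 2 ≤ k → k ≤ n ∸ 2 → CombIsomorphic k n (liftλ k n) (liftκ k n) → k ≡ 2
  isomorphic⇒k≡2 2 n _ _ _ = refl
  isomorphic⇒k≡2 k@(suc (suc (suc j))) n@(suc (suc m)) 2≤k k≤m iso = contradiction
    (VertexMap.HasUniversalVertex-reflect
      (lowerFaces-isFaceFamily λ≡h) (lowerFaces-isFaceFamily κ≡h)
      (CombIsomorphic⇒FaceIso {k = k} {n} {liftλ k n} {liftκ k n} iso) (liftκ-hasUniversalVertex k-1≤n-1))
    (¬hasUniversalVertex λ≡h (onesThenEndsWithZero-split j) 2≤k k≤m)
    where
    λ≡h = liftλ-isIndicatorOf (suc (suc j)) n
    k-1≤n-1 : suc (suc j) ≤ suc m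
    k-1≤n-1 = ℕ.≤-trans (ℕ.n≤1+n _) (ℕ.≤-trans k≤m (ℕ.n≤1+n m))
    κ≡h = proj₂ (proj₂ (liftκ-isIndicatorOf k-1≤n-1))
  isomorphic⇒k≡2 (suc zero)          _          (s≤s ()) _  _
  isomorphic⇒k≡2 (suc (suc (suc _))) zero       _        () _
  isomorphic⇒k≡2 (suc (suc (suc _))) (suc zero) _        () _
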